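{- Let $p$ be a prime and $\ell\ge1$. An idempotent (resp. nilpotent) sequence $f\in P_{p^\ell}$ is uniquely determined by its generating vector. That is, if $f,g$ are both idempotent (resp. both nilpotent) and $\mathrm{vect}(f)=\mathrm{vect}(g)$, then $f=g$.
   Context: $P_{p^\ell}$ is the module of periodic sequences $f:\mathbb{N}\to\mathbb{Z}_{p^\ell}$ and $\Delta f(n)=f(n+1)-f(n)$. A sequence $f$ is nilpotent (resp. idempotent) if $\Delta^\eta f=0$ (resp. $\Delta^\eta f=f$) for some $\eta\ge1$; the minimal such $\eta$ is its nilpotency (resp. idempotency) index. For such $f$ with index $\eta$, the generating vector is $\mathrm{vect}(f)=(e_0,\dots,e_{\eta-1})\in\mathbb{Z}_{p^\ell}^\eta$, where $e_i=\Delta^i f(0)$. -}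

module Defs where

open import Data.Nat using (ℕ; zero; suc; _+_; _∸_; _^_; NonZero; _≥_)
open import Data.Nat.DivMod using (_mod_)
open import Data.Nat.Properties using (m^n≢0)
open import Data.Nat.Primality using (Prime)
open import Data.Fin using (Fin; toℕ; cast)
open import Data.Vec.Functional using (Vector)
open import Data.Product using (Σ; ∃; ∃-syntax; _×_)
open import Relation.Binary.PropositionalEquality using (_≡_)

ℤ_ : ℕ → Set
ℤ m = Fin m

sub : ∀ m .{{_ : NonZero m}} → ℤ m → ℤ m → ℤ m
sub m a b = (toℕ a + (m ∸ toℕ b)) mod m

Seq : ℕ → Set
Seq m = ℕ → ℤ m

Periodic : ∀ {m} → Seq m → Set
Periodic f = ∃[ T ] (T ≥ 1 × (∀ n → f (n + T) ≡ f n))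

Δ : ∀ m .{{_ : NonZero m}} → Seq m → Seq m
Δ m f n = sub m (f (suc n)) (f n)

Δ^ : ∀ m .{{_ : NonZero m}} → ℕ → Seq m → Seq m
Δ^ m zero    f = f
Δ^ m (suc k) f = Δ m (Δ^ m k f)

IsNilpotencyIndex : ∀ m .{{_ : NonZero m}} → Seq m → ℕ → Set
IsNilpotencyIndex m f η =
  η ≥ 1 × (∀ n → Δ^ m η f n ≡ 0 mod m) × (∀ k → k ≥ 1 → (∀ n → Δ^ m k f n ≡ 0 mod m) → k ≥ η)

IsIdempotencyIndex : ∀ m .{{_ : NonZero m}} → Seq m → ℕ → Set
IsIdempotencyIndex m f η =
  η ≥ 1 × (∀ n → Δ^ m η f n ≡ f n) × (∀ k → k ≥ 1 → (∀ n → Δ^ m k f n ≡ f n) → k ≥ η)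

vect : ∀ m .{{_ : NonZero m}} → Seq m → (η : ℕ) → Vector (ℤ m) η
vect m f η i = Δ^ m (toℕ i) f 0

modNZ : ∀ {p} → Prime p → (ℓ : ℕ) → NonZero (p ^ ℓ)
modNZ {suc p} _ ℓ = m^n≢0 (suc p) ℓ
modNZ {zero} () ℓ

-- Equality of generating vectors (as elements of ℤ_m^η, so lengths must agree).
SameVect : ∀ {m} {η₁ η₂ : ℕ} → Vector (ℤ m) η₁ → Vector (ℤ m) η₂ → Set
SameVect {η₁ = η₁} {η₂} u v = Σ (η₁ ≡ η₂) λ e → ∀ i → u i ≡ v (cast e i)

-- Subtraction modulo m is cancellable, so a sequence is determined by its
-- initial value and its difference sequence. Applying this level by level,
-- the values Δⁱ f (n), i < η, at n + 1 are determined by those at n once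
-- Δ^η f (n) is: for a nilpotent f it is 0, for an idempotent f it is f (n).
-- Induction on n from the generating vector (the values at n = 0) then
-- shows f = g.
module Submission where

open import Defs
open import Data.Nat using (ℕ; zero; suc; _+_; _∸_; _<_; _≥_; _^_; NonZero)
open import Data.Nat.DivMod using (_%_; _mod_; %-distribˡ-+; [m+n]%n≡m%n; m<n⇒m%n≡m)
open import Data.Nat.Properties using (m≤n⇒m<n∨m≡n; m∸n+n≡m; +-assoc; <⇒≤)
open import Data.Nat.Primality using (Prime)
open import Data.Fin using (Fin; toℕ; fromℕ<; cast)
open import Data.Fin.Properties using (toℕ-fromℕ<; toℕ-injective; toℕ<n; toℕ-cast)
open import Data.Product using (_×_; _,_)
open import Data.Sum using (inj₁; inj₂)
open import Relation.Binary.PropositionalEquality using (_≡_; refl; sym; trans; cong; module ≡-Reasoning)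

module _ {m : ℕ} .{{_ : NonZero m}} where
  open ≡-Reasoning

  toℕ-sub+toℕ%≡toℕ : (a b : Fin m) → (toℕ (sub m a b) + toℕ b) % m ≡ toℕ a
  toℕ-sub+toℕ%≡toℕ a b = begin
      (toℕ ((A + (m ∸ B)) mod m) + B) % m  ≡⟨ cong (λ z → (z + B) % m) (toℕ-fromℕ< _) ⟩
      ((A + (m ∸ B)) % m + B) % m          ≡⟨ cong (λ z → ((A + (m ∸ B)) % m + z) % m) (sym (m<n⇒m%n≡m (toℕ<n b))) ⟩
      ((A + (m ∸ B)) % m + B % m) % m      ≡⟨ sym (%-distribˡ-+ (A + (m ∸ B)) B m) ⟩
      (A + (m ∸ B) + B) % m                ≡⟨ cong (_% m) (+-assoc A (m ∸ B) B) ⟩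
      (A + ((m ∸ B) + B)) % m              ≡⟨ cong (λ z → (A + z) % m) (m∸n+n≡m (<⇒≤ (toℕ<n b))) ⟩
      (A + m) % m                          ≡⟨ [m+n]%n≡m%n A m ⟩
      A % m                                ≡⟨ m<n⇒m%n≡m (toℕ<n a) ⟩
      A                                    ∎
    where
      A = toℕ a
      B = toℕ b

  sub-cancelʳ : (a a′ b : Fin m) → sub m a b ≡ sub m a′ b → a ≡ a′
  sub-cancelʳ a a′ b eq = toℕ-injective (begin
      toℕ a                          ≡⟨ sym (toℕ-sub+toℕ%≡toℕ a b) ⟩
      (toℕ (sub m a b) + toℕ b) % m  ≡⟨ cong (λ z → (toℕ z + toℕ b) % m) eq ⟩
      (toℕ (sub m a′ b) + toℕ b) % m ≡⟨ toℕ-sub+toℕ%≡toℕ a′ b ⟩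
      toℕ a′                         ∎)

  AgreeBelow : ℕ → Seq m → Seq m → ℕ → Set
  AgreeBelow η f g n = ∀ i → i < η → Δ^ m i f n ≡ Δ^ m i g n

  agreeBelow-step : ∀ {η f g n} →
    (AgreeBelow η f g n → Δ^ m η f n ≡ Δ^ m η g n) →
    AgreeBelow η f g n → AgreeBelow η f g (suc n)
  agreeBelow-step {η} {f} {g} {n} top agree i i<η =
    sub-cancelʳ (Δ^ m i f (suc n)) (Δ^ m i g (suc n)) (Δ^ m i f n) (begin
      Δ^ m (suc i) f n                          ≡⟨ nextLevel ⟩
      Δ^ m (suc i) g n                          ≡⟨ cong (sub m (Δ^ m i g (suc n))) (sym (agree i i<η)) ⟩
      sub m (Δ^ m i g (suc n)) (Δ^ m i f n)     ∎)
    where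
      nextLevel : Δ^ m (suc i) f n ≡ Δ^ m (suc i) g n
      nextLevel with m≤n⇒m<n∨m≡n i<η
      ... | inj₁ suc-i<η = agree (suc i) suc-i<η
      ... | inj₂ refl    = top agree

  agreeBelow-everywhere : ∀ {η f g} →
    (∀ n → AgreeBelow η f g n → Δ^ m η f n ≡ Δ^ m η g n) →
    AgreeBelow η f g 0 → ∀ n → AgreeBelow η f g n
  agreeBelow-everywhere _   agree₀ zero    = agree₀
  agreeBelow-everywhere top agree₀ (suc n) =
    agreeBelow-step (top n) (agreeBelow-everywhere top agree₀ n)

  sameVect⇒agreeBelow₀ : ∀ {f g η η′} →
    SameVect (vect m f η) (vect m g η′) → AgreeBelow η f g 0
  sameVect⇒agreeBelow₀ {f} {g} (e , same) i i<η = begin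
      Δ^ m i f 0                ≡⟨ cong (λ j → Δ^ m j f 0) (sym (toℕ-fromℕ< i<η)) ⟩
      Δ^ m (toℕ k) f 0          ≡⟨ same k ⟩
      Δ^ m (toℕ (cast e k)) g 0 ≡⟨ cong (λ j → Δ^ m j g 0) (trans (toℕ-cast e k) (toℕ-fromℕ< i<η)) ⟩
      Δ^ m i g 0                ∎
    where k = fromℕ< i<η

  idempotent-determinedByVect : ∀ {f g ηf ηg} →
    IsIdempotencyIndex m f ηf → IsIdempotencyIndex m g ηg →
    SameVect (vect m f ηf) (vect m g ηg) → ∀ n → f n ≡ g n
  idempotent-determinedByVect {f} {g} {η} (η≥1 , fixes-f , _) (_ , fixes-g , _) same@(refl , _) n =
    agreeBelow-everywhere top (sameVect⇒agreeBelow₀ same) n 0 η≥1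
    where
      top : ∀ n → AgreeBelow η f g n → Δ^ m η f n ≡ Δ^ m η g n
      top n agree = trans (fixes-f n) (trans (agree 0 η≥1) (sym (fixes-g n)))

  nilpotent-determinedByVect : ∀ {f g ηf ηg} →
    IsNilpotencyIndex m f ηf → IsNilpotencyIndex m g ηg →
    SameVect (vect m f ηf) (vect m g ηg) → ∀ n → f n ≡ g n
  nilpotent-determinedByVect (η≥1 , kills-f , _) (_ , kills-g , _) same@(refl , _) n =
    agreeBelow-everywhere (λ n _ → trans (kills-f n) (sym (kills-g n))) (sameVect⇒agreeBelow₀ same) n 0 η≥1

proposition2p10 : (p ℓ : ℕ) (pr : Prime p) → ℓ ≥ 1 →
    (∀ (f g : Seq (p ^ ℓ)) → Periodic f → Periodic g → (ηf ηg : ℕ) →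
      IsIdempotencyIndex (p ^ ℓ) {{modNZ pr ℓ}} f ηf →
      IsIdempotencyIndex (p ^ ℓ) {{modNZ pr ℓ}} g ηg →
      SameVect (vect (p ^ ℓ) {{modNZ pr ℓ}} f ηf) (vect (p ^ ℓ) {{modNZ pr ℓ}} g ηg) →
      ∀ n → f n ≡ g n)
  × (∀ (f g : Seq (p ^ ℓ)) → Periodic f → Periodic g → (ηf ηg : ℕ) →
      IsNilpotencyIndex (p ^ ℓ) {{modNZ pr ℓ}} f ηf →
      IsNilpotencyIndex (p ^ ℓ) {{modNZ pr ℓ}} g ηg →
      SameVect (vect (p ^ ℓ) {{modNZ pr ℓ}} f ηf) (vect (p ^ ℓ) {{modNZ pr ℓ}} g ηg) →
      ∀ n → f n ≡ g n)
proposition2p10 p ℓ pr _ =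
    (λ _ _ _ _ _ _ → idempotent-determinedByVect)
  , (λ _ _ _ _ _ _ → nilpotent-determinedByVect)
  where instance
    p^ℓ≢0 : NonZero (p ^ ℓ)
    p^ℓ≢0 = modNZ pr ℓ
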